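{- Let $n \in \mathbb{N}$. Then $$N(1,3,9,9;\,8n+22) = 40\, t'(1,3,9,9;\,n).$$
   Context: $\mathbb{N}$ denotes the set of positive integers. For $a,b,c,d\in\mathbb{N}$ and an integer $m\ge 0$, $N(a,b,c,d;m)$ is the number of $(x,y,z,w)\in\mathbb{Z}^4$ with $m = ax^2+by^2+cz^2+dw^2$, and $t'(a,b,c,d;m)$ is the number of $(x,y,z,w)\in\mathbb{N}^4$ with $m = a\frac{x(x-1)}{2}+b\frac{y(y-1)}{2}+c\frac{z(z-1)}{2}+d\frac{w(w-1)}{2}$. -}

module Defs where

open import Data.Nat using (ℕ; zero; suc; _+_; _*_; _/_)
open import Data.Integer as ℤ using (ℤ; +_; -[1+_])
open import Data.List using (List; []; _∷_; map; concatMap; length; filterᵇ; upTo; _++_)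
open import Data.Bool using (Bool)
open import Data.Nat using (_≡ᵇ_)
open import Data.Product using (_×_; _,_)

intRange : ℕ → List ℤ
intRange B = map +_ (upTo (suc B)) ++ map -[1+_] (upTo B)

natRange : ℕ → List ℕ
natRange B = map suc (upTo B)

quads : {A : Set} → List A → List (A × A × A × A)
quads xs = concatMap (λ x → concatMap (λ y → concatMap (λ z → map (λ w → (x , y , z , w)) xs) xs) xs) xs

sq : ℤ → ℕ
sq x = ℤ.∣ x ∣ * ℤ.∣ x ∣

tri' : ℕ → ℕ
tri' x = (x * (x Data.Nat.∸ 1)) / 2

-- N(a,b,c,d;m) : number of (x,y,z,w) ∈ ℤ⁴ with m = ax²+by²+cz²+dw².
-- Any solution has |x|,|y|,|z|,|w| ≤ m (as a,b,c,d ≥ 1), so counting over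
-- the box [-m,m]⁴ counts all solutions.
N : ℕ → ℕ → ℕ → ℕ → ℕ → ℕ
N a b c d m = length (filterᵇ ok (quads (intRange m)))
  where
  ok : ℤ × ℤ × ℤ × ℤ → Bool
  ok (x , y , z , w) = (a * sq x + b * sq y + c * sq z + d * sq w) ≡ᵇ m

-- t'(a,b,c,d;m) : number of (x,y,z,w) ∈ ℕ⁴ (positive integers) with
-- m = a x(x-1)/2 + b y(y-1)/2 + c z(z-1)/2 + d w(w-1)/2.
-- Any solution has x ≤ m+1 (since x(x-1)/2 ≥ x-1), so counting over
-- [1, m+1]⁴ counts all solutions.
t' : ℕ → ℕ → ℕ → ℕ → ℕ → ℕ
t' a b c d m = length (filterᵇ ok (quads (natRange (suc m))))
  where
  ok : ℕ × ℕ × ℕ × ℕ → Bool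
  ok (x , y , z , w) = (a * tri' x + b * tri' y + c * tri' z + d * tri' w) ≡ᵇ m

{-# OPTIONS --safe #-}

-- Modulo 4, a solution of x² + 3y² + 9z² + 9w² = 8n + 22 has all coordinates odd, or exactly
-- (x, y), (y, w) or (y, z) even.  Writing odd integers as ±(2a − 1), where (2a − 1)² = 1 + 8·a(a − 1)/2,
-- the all-odd solutions are the solutions counted by t'(n) together with 16 choices of signs.
-- For a pair (a, b) of equal parity, (a + b√−3)/2 is an Eisenstein integer, and multiplying it by
-- the units (1 ± √−3)/2 preserves a² + 3b².  Split by the parity of (x + y)/2, each half of the
-- all-odd solutions is carried bijectively onto the solutions with x, y even, and likewise for the
-- pair (y, w); swapping z and w matches the last two classes.  Hence N = (16 + 8 + 8 + 8)·t'(n).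

module Submission where

open import Level using (0ℓ)
open import Function using (_∘_; id)
open import Data.Nat as ℕ using (ℕ; zero; suc; _∸_; _≤_; z≤n; s≤s; NonZero)
import Data.Nat.Properties as ℕ
import Data.Nat.Literals as ℕ
open import Data.Integer as ℤ using (ℤ; +_; -[1+_]; ∣_∣)
import Data.Integer.Properties as ℤ
import Data.Integer.Literals as ℤ
open import Agda.Builtin.FromNat using (Number; fromNat)
open import Data.Bool as Bool using (Bool; true; false)
open import Data.Unit using (⊤; tt)
open import Data.Empty using (⊥-elim)
open import Data.Product using (_×_; _,_; proj₁; proj₂; ∃)
open import Data.Sum using (inj₁; inj₂)
open import Data.List
  using (List; []; _∷_; _++_; map; filter; filterᵇ; length; concat; concatMap; cartesianProduct; upTo)
open import Data.List.Membership.Propositional using (_∈_)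
open import Data.List.Relation.Unary.Any as Any using (here; there)
open import Data.List.Relation.Unary.All as All using ([]; _∷_)
open import Data.List.Relation.Unary.AllPairs using ([]; _∷_)
open import Data.List.Relation.Unary.Unique.Propositional using (Unique)
import Data.List.Relation.Unary.Unique.Propositional.Properties as Unique
open import Data.List.Relation.Binary.Disjoint.Propositional using (Disjoint)
open import Relation.Binary.PropositionalEquality
  using (_≡_; _≢_; refl; sym; trans; cong; cong₂; subst; module ≡-Reasoning)
open import Relation.Binary.Definitions using (DecidableEquality)
open import Relation.Unary using (Pred; Decidable; _∩_; _⟨×⟩_)

open import Defs

instance
  ℕ-number : Number ℕ
  ℕ-number = ℕ.number
  ℤ-number : Number ℤ
  ℤ-number = ℤ.number
  ⊤-instance : ⊤
  ⊤-instance = tt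

module Enumeration where

  open import Data.Nat using (_+_; _*_)
  open import Data.Nat.Properties using (≤-antisym; module ≤-Reasoning)
  open import Data.Nat.ListAction using (sum)
  open import Data.List.Properties using (length-map; length-++; map-∘; map-id-local; length-removeAt′)
  open import Data.List.Membership.Propositional.Properties
    using (∈-map⁻; ∈-filter⁺; ∈-filter⁻; ∈-cartesianProduct⁺; ∈-cartesianProduct⁻; ∈-concatMap⁺; ∈-concatMap⁻)
  open import Data.List.Relation.Unary.Any using (_─_; index)
  import Data.List.Relation.Unary.All.Properties as All
  import Data.List.Relation.Unary.AllPairs as AllPairs
  import Data.List.Relation.Unary.AllPairs.Properties as AllPairs

  record Enumerates {A : Set} (P : Pred A 0ℓ) (xs : List A) : Set where
    field
      unique   : Unique xs
      sound    : ∀ {a} → a ∈ xs → P a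
      complete : ∀ {a} → P a → a ∈ xs
  open Enumerates public

  record Bijection {A B : Set} (P : Pred A 0ℓ) (Q : Pred B 0ℓ) : Set where
    field
      to      : A → B
      from    : B → A
      to-∈    : ∀ {a} → P a → Q (to a)
      from-∈  : ∀ {b} → Q b → P (from b)
      from∘to : ∀ {a} → P a → from (to a) ≡ a
      to∘from : ∀ {b} → Q b → to (from b) ≡ b

  Bijection-sym : {A B : Set} {P : Pred A 0ℓ} {Q : Pred B 0ℓ} → Bijection P Q → Bijection Q P
  Bijection-sym f = record
    { to = from ; from = to ; to-∈ = from-∈ ; from-∈ = to-∈ ; from∘to = to∘from ; to∘from = from∘to }
    where open Bijection f

  module _ {A : Set} {P Q : Pred A 0ℓ} {xs : List A} where

    enumerates-cong : (∀ {a} → P a → Q a) → (∀ {a} → Q a → P a) → Enumerates P xs → Enumerates Q xs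
    enumerates-cong P⇒Q Q⇒P e = record
      { unique = unique e ; sound = P⇒Q ∘ sound e ; complete = complete e ∘ Q⇒P }

    enumerates-filter : (Q? : Decidable Q) → Enumerates P xs → Enumerates (P ∩ Q) (filter Q? xs)
    enumerates-filter Q? e = record
      { unique   = Unique.filter⁺ Q? (unique e)
      ; sound    = λ a∈ → let a∈xs , qa = ∈-filter⁻ Q? a∈ in sound e a∈xs , qa
      ; complete = λ (pa , qa) → ∈-filter⁺ Q? (complete e pa) qa
      }

  enumerates-cartesianProduct : {A B : Set} {P : Pred A 0ℓ} {Q : Pred B 0ℓ} {xs : List A} {ys : List B} →
    Enumerates P xs → Enumerates Q ys → Enumerates (P ⟨×⟩ Q) (cartesianProduct xs ys)
  enumerates-cartesianProduct {xs = xs} {ys} e f = record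
    { unique   = Unique.cartesianProduct⁺ (unique e) (unique f)
    ; sound    = λ ab∈ → let a∈ , b∈ = ∈-cartesianProduct⁻ xs ys ab∈ in sound e a∈ , sound f b∈
    ; complete = λ (pa , qb) → ∈-cartesianProduct⁺ (complete e pa) (complete f qb)
    }

  module _ {A : Set} where

    ∈-─ : ∀ {x y : A} {ys} (x∈ys : x ∈ ys) → y ∈ ys → y ≢ x → y ∈ (ys ─ x∈ys)
    ∈-─ (here refl)  (here refl)  y≢x = ⊥-elim (y≢x refl)
    ∈-─ (here refl)  (there y∈ys) _   = y∈ys
    ∈-─ (there x∈ys) (here refl)  _   = here refl
    ∈-─ (there x∈ys) (there y∈ys) y≢x = there (∈-─ x∈ys y∈ys y≢x)

    length-≤-unique-⊆ : ∀ {xs ys : List A} → Unique xs → (∀ {a} → a ∈ xs → a ∈ ys) → length xs ≤ length ys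
    length-≤-unique-⊆ {[]}     _          _     = z≤n
    length-≤-unique-⊆ {x ∷ xs} {ys} (x∉xs ∷ u) xs⊆ys = begin
      suc (length xs)           ≤⟨ s≤s (length-≤-unique-⊆ u xs⊆ys─x) ⟩
      suc (length (ys ─ x∈ys))  ≡⟨ length-removeAt′ ys (index x∈ys) ⟨
      length ys                 ∎
      where
      open ≤-Reasoning
      x∈ys : x ∈ ys
      x∈ys = xs⊆ys (here refl)
      xs⊆ys─x : ∀ {a} → a ∈ xs → a ∈ (ys ─ x∈ys)
      xs⊆ys─x a∈xs = ∈-─ x∈ys (xs⊆ys (there a∈xs)) (λ a≡x → All.lookup x∉xs a∈xs (sym a≡x))

  length-≤-retraction : {A B : Set} {P : Pred A 0ℓ} {Q : Pred B 0ℓ} {xs : List A} {ys : List B} →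
    (f : A → B) (g : B → A) → (∀ {a} → P a → Q (f a)) → (∀ {a} → P a → g (f a) ≡ a) →
    Enumerates P xs → Enumerates Q ys → length xs ≤ length ys
  length-≤-retraction {xs = xs} {ys} f g f-∈ g∘f e e′ = begin
    length xs          ≡⟨ length-map f xs ⟨
    length (map f xs)  ≤⟨ length-≤-unique-⊆ unique-fxs fxs⊆ys ⟩
    length ys          ∎
    where
    open ≤-Reasoning
    gfxs≡xs : map g (map f xs) ≡ xs
    gfxs≡xs = trans (sym (map-∘ xs)) (map-id-local (All.tabulate (g∘f ∘ sound e)))
    unique-fxs : Unique (map f xs)
    unique-fxs = Unique.map⁻ (subst Unique (sym gfxs≡xs) (unique e))
    fxs⊆ys : ∀ {b} → b ∈ map f xs → b ∈ ys
    fxs⊆ys b∈ with a , a∈xs , refl ← ∈-map⁻ f b∈ = complete e′ (f-∈ (sound e a∈xs))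

  length-≡-bijection : {A B : Set} {P : Pred A 0ℓ} {Q : Pred B 0ℓ} {xs : List A} {ys : List B} →
                       Bijection P Q → Enumerates P xs → Enumerates Q ys → length xs ≡ length ys
  length-≡-bijection φ e e′ = ≤-antisym
    (length-≤-retraction to from to-∈ from∘to e e′)
    (length-≤-retraction from to from-∈ to∘from e′ e)
    where open Bijection φ

  length-≡-equivalent : {A : Set} {P Q : Pred A 0ℓ} {xs ys : List A} →
    (∀ {a} → P a → Q a) → (∀ {a} → Q a → P a) → Enumerates P xs → Enumerates Q ys → length xs ≡ length ys
  length-≡-equivalent P⇒Q Q⇒P = length-≡-bijection (record
    { to = id ; from = id ; to-∈ = P⇒Q ; from-∈ = Q⇒P ; from∘to = λ _ → refl ; to∘from = λ _ → refl })

  length-concat : {A : Set} (xss : List (List A)) → length (concat xss) ≡ sum (map length xss)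
  length-concat []         = refl
  length-concat (xs ∷ xss) = trans (length-++ xs) (cong (λ n → length xs + n) (length-concat xss))

  length-cartesianProduct : {A B : Set} (xs : List A) (ys : List B) →
                            length (cartesianProduct xs ys) ≡ length xs * length ys
  length-cartesianProduct []       ys = refl
  length-cartesianProduct (x ∷ xs) ys = begin
    length (map (x ,_) ys ++ cartesianProduct xs ys)          ≡⟨ length-++ (map (x ,_) ys) ⟩
    length (map (x ,_) ys) + length (cartesianProduct xs ys)  ≡⟨ cong₂ _+_ (length-map (x ,_) ys)
                                                                   (length-cartesianProduct xs ys) ⟩
    length ys + length xs * length ys                         ∎
    where open ≡-Reasoning

  module _ {A K : Set} {P : Pred A 0ℓ} {xs : List A} (_≟_ : DecidableEquality K) (f : A → K) where

    fibre : K → List A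
    fibre k = filter (λ a → f a ≟ k) xs

    ∈-fibre⁻ : ∀ {a k} → a ∈ fibre k → a ∈ xs × f a ≡ k
    ∈-fibre⁻ {k = k} = ∈-filter⁻ (λ a → f a ≟ k) {xs = xs}

    enumerates-concat-fibres : ∀ {ks} → Unique ks → (∀ {a} → P a → f a ∈ ks) →
                               Enumerates P xs → Enumerates P (concatMap fibre ks)
    enumerates-concat-fibres {ks} unique-ks f∈ks e = record
      { unique   = Unique.concat⁺ (All.map⁺ (All.universal (λ _ → Unique.filter⁺ _ (unique e)) ks))
                                  (AllPairs.map⁺ (AllPairs.map disjoint unique-ks))
      ; sound    = λ a∈ → let _ , a∈fibre = Any.satisfied (∈-concatMap⁻ fibre {xs = ks} a∈)
                           in sound e (proj₁ (∈-fibre⁻ a∈fibre))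
      ; complete = λ pa → ∈-concatMap⁺ fibre (Any.map (∈-filter⁺ _ (complete e pa)) (f∈ks pa))
      }
      where
      disjoint : ∀ {k k′} → k ≢ k′ → Disjoint (fibre k) (fibre k′)
      disjoint k≢k′ (a∈k , a∈k′) = k≢k′ (trans (sym (proj₂ (∈-fibre⁻ a∈k))) (proj₂ (∈-fibre⁻ a∈k′)))

    length-fibres : ∀ {ks} → Unique ks → (∀ {a} → P a → f a ∈ ks) →
                    Enumerates P xs → length xs ≡ sum (map (length ∘ fibre) ks)
    length-fibres {ks} unique-ks f∈ks e = begin
      length xs                        ≡⟨ length-≡-equivalent id id e (enumerates-concat-fibres unique-ks f∈ks e) ⟩
      length (concatMap fibre ks)      ≡⟨ length-concat (map fibre ks) ⟩
      sum (map length (map fibre ks))  ≡⟨ cong sum (map-∘ ks) ⟨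
      sum (map (length ∘ fibre) ks)    ∎
      where open ≡-Reasoning

open Enumeration

module Representations where

  open import Data.Nat using (_+_; _*_; _/_; _≡ᵇ_)
  open import Data.Nat.Properties
    using (≤-trans; m≤m+n; m≤n+m; m≤m*n; m≤n*m; ≡ᵇ⇒≡; ≡⇒≡ᵇ; *-cancelˡ-≤; *-monoˡ-≤; *-comm; *-distribˡ-+)
  open import Data.Nat.DivMod using (m*n/n≡m)
  open import Data.Nat.Tactic.RingSolver using (solve-∀)
  open import Data.List.Properties using (map-∘; map-++; map-id; concatMap-cong)
  open import Data.List.Membership.Propositional.Properties
    using (∈-map⁺; ∈-map⁻; ∈-++⁺ˡ; ∈-++⁺ʳ; ∈-++⁻; ∈-upTo⁺; ∈-upTo⁻)
  open import Relation.Nullary.Decidable using (T?)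

  concatMap-map≡map-cartesianProduct : {A B C : Set} (g : A × B → C) (xs : List A) (ys : List B) →
    concatMap (λ x → map (λ y → g (x , y)) ys) xs ≡ map g (cartesianProduct xs ys)
  concatMap-map≡map-cartesianProduct g []       ys = refl
  concatMap-map≡map-cartesianProduct g (x ∷ xs) ys = begin
    map (λ y → g (x , y)) ys ++ concatMap (λ x → map (λ y → g (x , y)) ys) xs
      ≡⟨ cong₂ _++_ (map-∘ ys) (concatMap-map≡map-cartesianProduct g xs ys) ⟩
    map g (map (x ,_) ys) ++ map g (cartesianProduct xs ys)
      ≡⟨ map-++ g (map (x ,_) ys) _ ⟨
    map g (cartesianProduct (x ∷ xs) ys) ∎
    where open ≡-Reasoning

  quads≡cartesianProduct : {A : Set} (xs : List A) →
    quads xs ≡ cartesianProduct xs (cartesianProduct xs (cartesianProduct xs xs))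
  quads≡cartesianProduct xs = begin
    quads xs
      ≡⟨ concatMap-cong (λ x → concatMap-cong (λ y →
           concatMap-map≡map-cartesianProduct (λ zw → x , y , zw) xs xs) xs) xs ⟩
    concatMap (λ x → concatMap (λ y → map (λ zw → x , y , zw) (cartesianProduct xs xs)) xs) xs
      ≡⟨ concatMap-cong (λ x → concatMap-map≡map-cartesianProduct (x ,_) xs (cartesianProduct xs xs)) xs ⟩
    concatMap (λ x → map (x ,_) (cartesianProduct xs (cartesianProduct xs xs))) xs
      ≡⟨ concatMap-map≡map-cartesianProduct id xs _ ⟩
    map id (cartesianProduct xs (cartesianProduct xs (cartesianProduct xs xs)))
      ≡⟨ map-id _ ⟩
    cartesianProduct xs (cartesianProduct xs (cartesianProduct xs xs)) ∎
    where open ≡-Reasoning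

  enumerates-quads : {A : Set} {P : Pred A 0ℓ} {xs : List A} →
                     Enumerates P xs → Enumerates (P ⟨×⟩ P ⟨×⟩ P ⟨×⟩ P) (quads xs)
  enumerates-quads {xs = xs} e = subst (Enumerates _) (sym (quads≡cartesianProduct xs))
    (enumerates-cartesianProduct e (enumerates-cartesianProduct e (enumerates-cartesianProduct e e)))

  enumerates-intRange : ∀ B → Enumerates (λ x → ℤ.∣ x ∣ ≤ B) (intRange B)
  enumerates-intRange B = record
    { unique   = Unique.++⁺ (Unique.map⁺ (λ { refl → refl }) (Unique.upTo⁺ (suc B)))
                            (Unique.map⁺ (λ { refl → refl }) (Unique.upTo⁺ B)) nonneg-disjoint-neg
    ; sound    = sound′
    ; complete = complete′
    }
    where
    nonneg-disjoint-neg : Disjoint (map +_ (upTo (suc B))) (map -[1+_] (upTo B))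
    nonneg-disjoint-neg (p , q) with _ , _ , refl ← ∈-map⁻ +_ p | _ , _ , () ← ∈-map⁻ -[1+_] q
    sound′ : ∀ {x} → x ∈ intRange B → ℤ.∣ x ∣ ≤ B
    sound′ x∈ with ∈-++⁻ (map +_ (upTo (suc B))) x∈
    ... | inj₁ x∈nonneg with _ , n∈ , refl ← ∈-map⁻ +_ x∈nonneg = ℕ.s≤s⁻¹ (∈-upTo⁻ n∈)
    ... | inj₂ x∈neg    with _ , n∈ , refl ← ∈-map⁻ -[1+_] x∈neg = ∈-upTo⁻ n∈
    complete′ : ∀ {x} → ℤ.∣ x ∣ ≤ B → x ∈ intRange B
    complete′ {+ n}      n≤B = ∈-++⁺ˡ (∈-map⁺ +_ (∈-upTo⁺ (s≤s n≤B)))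
    complete′ { -[1+ n ]} n<B = ∈-++⁺ʳ (map +_ (upTo (suc B))) (∈-map⁺ -[1+_] (∈-upTo⁺ n<B))

  signs : List (Bool × Bool × Bool × Bool)
  signs = quads (true ∷ false ∷ [])

  enumerates-signs : Enumerates (λ _ → ⊤) signs
  enumerates-signs = enumerates-cong (λ _ → tt) (λ _ → tt , tt , tt , tt) (enumerates-quads enumerates-bools)
    where
    enumerates-bools : Enumerates (λ _ → ⊤) (true ∷ false ∷ [])
    enumerates-bools = record
      { unique   = ((λ ()) ∷ []) ∷ [] ∷ []
      ; sound    = λ _ → tt
      ; complete = λ { {true} _ → here refl ; {false} _ → there (here refl) }
      }

  enumerates-natRange : ∀ B → Enumerates (λ u → 1 ≤ u × u ≤ B) (natRange B)
  enumerates-natRange B = record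
    { unique   = Unique.map⁺ (λ { refl → refl }) (Unique.upTo⁺ B)
    ; sound    = λ u∈ → let _ , n∈ , u≡ = ∈-map⁻ suc u∈ in subst (λ u → 1 ≤ u × u ≤ B) (sym u≡) (s≤s z≤n , ∈-upTo⁻ n∈)
    ; complete = λ { {suc n} (_ , n<B) → ∈-map⁺ suc (∈-upTo⁺ n<B) }
    }

  summands-≤ : ∀ {p q r s m} → p + q + r + s ≡ m → p ≤ m × q ≤ m × r ≤ m × s ≤ m
  summands-≤ {p} {q} {r} {s} refl =
    ≤-trans (m≤m+n p q) pq≤ , ≤-trans (m≤n+m q p) pq≤ , ≤-trans (m≤n+m r (p + q)) pqr≤ , m≤n+m s (p + q + r)
    where
    pqr≤ : p + q + r ≤ p + q + r + s
    pqr≤ = m≤m+n (p + q + r) s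
    pq≤ : p + q ≤ p + q + r + s
    pq≤ = ≤-trans (m≤m+n (p + q) r) pqr≤

  n≤n*n : ∀ n → n ≤ n * n
  n≤n*n zero    = z≤n
  n≤n*n (suc n) = m≤m*n (suc n) (suc n)

  suc*-even : ∀ j → ∃ λ t → suc j * j ≡ 2 * t
  suc*-even zero = 0 , refl
  suc*-even (suc j) with t , eq ← suc*-even j = t + suc j , (begin
    suc (suc j) * suc j    ≡⟨ expand j ⟩
    suc j * j + 2 * suc j  ≡⟨ cong (_+ 2 * suc j) eq ⟩
    2 * t + 2 * suc j      ≡⟨ *-distribˡ-+ 2 t (suc j) ⟨
    2 * (t + suc j)        ∎)
    where
    open ≡-Reasoning
    expand : ∀ j → suc (suc j) * suc j ≡ suc j * j + 2 * suc j
    expand = solve-∀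

  double-tri' : ∀ j → 2 * tri' (suc j) ≡ suc j * j
  double-tri' j with t , eq ← suc*-even j = begin
    2 * ((suc j * j) / 2)  ≡⟨ cong (λ m → 2 * (m / 2)) eq ⟩
    2 * ((2 * t) / 2)      ≡⟨ cong (λ m → 2 * (m / 2)) (*-comm 2 t) ⟩
    2 * ((t * 2) / 2)      ≡⟨ cong (2 *_) (m*n/n≡m t 2) ⟩
    2 * t                  ≡⟨ eq ⟨
    suc j * j              ∎
    where open ≡-Reasoning

  ≤-suc-tri' : ∀ u → u ≤ suc (tri' u)
  ≤-suc-tri' zero    = z≤n
  ≤-suc-tri' (suc j) = s≤s (*-cancelˡ-≤ 2 (subst (2 * j ≤_) (sym (double-tri' j)) (double≤ j)))
    where
    double≤ : ∀ j → 2 * j ≤ suc j * j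
    double≤ zero    = z≤n
    double≤ (suc i) = *-monoˡ-≤ (suc i) {2} {suc (suc i)} (s≤s (s≤s z≤n))

  AllPositive : Pred (ℕ × ℕ × ℕ × ℕ) 0ℓ
  AllPositive = 1 ≤_ ⟨×⟩ 1 ≤_ ⟨×⟩ 1 ≤_ ⟨×⟩ 1 ≤_

  module _ (a b c d : ℕ) where

    quadraticForm : ℤ × ℤ × ℤ × ℤ → ℕ
    quadraticForm (x , y , z , w) = a * sq x + b * sq y + c * sq z + d * sq w

    representations : ℕ → List (ℤ × ℤ × ℤ × ℤ)
    representations m = filterᵇ (λ v → quadraticForm v ≡ᵇ m) (quads (intRange m))

    N≡length-representations : ∀ m → N a b c d m ≡ length (representations m)
    N≡length-representations m = refl

    triangularForm : ℕ × ℕ × ℕ × ℕ → ℕ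
    triangularForm (p , q , r , s) = a * tri' p + b * tri' q + c * tri' r + d * tri' s

    triangularRepresentations : ℕ → List (ℕ × ℕ × ℕ × ℕ)
    triangularRepresentations m = filterᵇ (λ u → triangularForm u ≡ᵇ m) (quads (natRange (suc m)))

    t'≡length-triangularRepresentations : ∀ m → t' a b c d m ≡ length (triangularRepresentations m)
    t'≡length-triangularRepresentations m = refl

    module _ .{{_ : NonZero a}} .{{_ : NonZero b}} .{{_ : NonZero c}} .{{_ : NonZero d}} where

      enumerates-representations : ∀ m → Enumerates (λ v → quadraticForm v ≡ m) (representations m)
      enumerates-representations m = enumerates-cong
        (λ {v} (_ , form≡ᵇm) → ≡ᵇ⇒≡ (quadraticForm v) m form≡ᵇm)
        (λ {v} form≡m → in-box v form≡m , ≡⇒≡ᵇ (quadraticForm v) m form≡m)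
        (enumerates-filter (T? ∘ λ v → quadraticForm v ≡ᵇ m) (enumerates-quads (enumerates-intRange m)))
        where
        Box : Pred ℤ 0ℓ
        Box x = ℤ.∣ x ∣ ≤ m
        bound : ∀ {k} x .{{_ : NonZero k}} → k * sq x ≤ m → ℤ.∣ x ∣ ≤ m
        bound {k} x k*sq≤m = ≤-trans (n≤n*n ℤ.∣ x ∣) (≤-trans (m≤n*m (sq x) k) k*sq≤m)
        in-box : ∀ v → quadraticForm v ≡ m → (Box ⟨×⟩ Box ⟨×⟩ Box ⟨×⟩ Box) v
        in-box (x , y , z , w) form≡m with ax≤ , by≤ , cz≤ , dw≤ ← summands-≤ {a * sq x} form≡m =
          bound x ax≤ , bound y by≤ , bound z cz≤ , bound w dw≤

      enumerates-triangularRepresentations : ∀ m →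
        Enumerates (λ u → AllPositive u × triangularForm u ≡ m) (triangularRepresentations m)
      enumerates-triangularRepresentations m = enumerates-cong
        (λ {u} (in-box , form≡ᵇm) → positive u in-box , ≡ᵇ⇒≡ (triangularForm u) m form≡ᵇm)
        (λ {u} (pos , form≡m) → to-box u pos form≡m , ≡⇒≡ᵇ (triangularForm u) m form≡m)
        (enumerates-filter (T? ∘ λ u → triangularForm u ≡ᵇ m) (enumerates-quads (enumerates-natRange (suc m))))
        where
        Box : Pred ℕ 0ℓ
        Box p = 1 ≤ p × p ≤ suc m
        positive : ∀ u → (Box ⟨×⟩ Box ⟨×⟩ Box ⟨×⟩ Box) u → AllPositive u
        positive (p , q , r , s) ((1≤p , _) , (1≤q , _) , (1≤r , _) , (1≤s , _)) = 1≤p , 1≤q , 1≤r , 1≤s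
        bound : ∀ {k} p .{{_ : NonZero k}} → 1 ≤ p → k * tri' p ≤ m → 1 ≤ p × p ≤ suc m
        bound {k} p 1≤p k*tri≤m = 1≤p , ≤-trans (≤-suc-tri' p) (s≤s (≤-trans (m≤n*m (tri' p) k) k*tri≤m))
        to-box : ∀ u → AllPositive u → triangularForm u ≡ m → (Box ⟨×⟩ Box ⟨×⟩ Box ⟨×⟩ Box) u
        to-box (p , q , r , s) (1≤p , 1≤q , 1≤r , 1≤s) form≡m with ap≤ , bq≤ , cr≤ , ds≤ ← summands-≤ {a * tri' p} form≡m =
          bound p 1≤p ap≤ , bound q 1≤q bq≤ , bound r 1≤r cr≤ , bound s 1≤s ds≤

open Representations

module Parity where

  open import Data.Nat using (_≡ᵇ_)
  open import Data.Integer using (_+_; _-_; _*_; _%ℕ_; _/ℕ_)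
  open import Data.Integer.DivMod using (a≡a%ℕn+[a/ℕn]*n; n%ℕd<d)
  open import Data.Integer.Tactic.RingSolver using (solve-∀)
  open import Algebra.Properties.AbelianGroup ℤ.+-0-abelianGroup using () renaming (∙-cancelˡ to +-cancelˡ)

  bit : Bool → ℤ
  bit false = 0
  bit true  = 1

  -- Everything below uses parity and half only through bit-parity-half; being opaque, parity x
  -- never unfolds into _%ℕ_, so unification can recover x from it.
  opaque
    parity : ℤ → Bool
    parity x = x %ℕ 2 ≡ᵇ 1

    half : ℤ → ℤ
    half x = x /ℕ 2

    bit-parity-half : ∀ x → x ≡ bit (parity x) + 2 * half x
    bit-parity-half x = begin
      x                            ≡⟨ a≡a%ℕn+[a/ℕn]*n x 2 ⟩
      + (x %ℕ 2) + x /ℕ 2 * 2      ≡⟨ cong₂ _+_ (bit-residue (x %ℕ 2) (n%ℕd<d x 2)) (ℤ.*-comm 2 (x /ℕ 2)) ⟨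
      bit (parity x) + 2 * half x  ∎
      where
      open ≡-Reasoning
      bit-residue : ∀ r → r ℕ.< 2 → bit (r ≡ᵇ 1) ≡ + r
      bit-residue 0 _ = refl
      bit-residue 1 _ = refl
      bit-residue (suc (suc _)) (s≤s (s≤s ()))

  1≢2* : ∀ m → 1 ≢ 2 * m
  1≢2* m 1≡2m with () ← ℕ.m*n≡1⇒m≡1 2 ∣ m ∣ (sym (trans (cong ∣_∣ 1≡2m) (ℤ.abs-* 2 m)))

  bit+2*-injective : ∀ b b′ k k′ → bit b + 2 * k ≡ bit b′ + 2 * k′ → b ≡ b′ × k ≡ k′
  bit+2*-injective false false k k′ eq = refl , ℤ.*-cancelˡ-≡ 2 k k′ (+-cancelˡ 0 (2 * k) (2 * k′) eq)
  bit+2*-injective true  true  k k′ eq = refl , ℤ.*-cancelˡ-≡ 2 k k′ (+-cancelˡ 1 (2 * k) (2 * k′) eq)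
  bit+2*-injective false true  k k′ eq = ⊥-elim (1≢2* (k - k′) (begin
    1                      ≡⟨ cancel k′ ⟩
    1 + 2 * k′ - 2 * k′    ≡⟨ cong (_- 2 * k′) eq ⟨
    0 + 2 * k - 2 * k′     ≡⟨ factor k k′ ⟩
    2 * (k - k′)           ∎))
    where
    open ≡-Reasoning
    cancel : ∀ k′ → 1 ≡ 1 + 2 * k′ - 2 * k′
    cancel = solve-∀
    factor : ∀ k k′ → 0 + 2 * k - 2 * k′ ≡ 2 * (k - k′)
    factor = solve-∀
  bit+2*-injective true  false k k′ eq with () ← proj₁ (bit+2*-injective false true k′ k (sym eq))

  bit-half-unique : ∀ {x} b k → x ≡ bit b + 2 * k → parity x ≡ b × half x ≡ k
  bit-half-unique {x} b k eq = bit+2*-injective _ _ _ _ (trans (sym (bit-parity-half x)) eq)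

  parity-even : ∀ {x} k → x ≡ 2 * k → parity x ≡ false
  parity-even k eq = proj₁ (bit-half-unique false k (trans eq (sym (ℤ.+-identityˡ _))))

  parity-odd : ∀ {x} k → x ≡ 1 + 2 * k → parity x ≡ true
  parity-odd k eq = proj₁ (bit-half-unique true k eq)

  half-even : ∀ {x} k → x ≡ 2 * k → half x ≡ k
  half-even k eq = proj₂ (bit-half-unique false k (trans eq (sym (ℤ.+-identityˡ _))))

  half-odd : ∀ {x} k → x ≡ 1 + 2 * k → half x ≡ k
  half-odd k eq = proj₂ (bit-half-unique true k eq)

  even-view : ∀ x → parity x ≡ false → x ≡ 2 * half x
  even-view x even = trans (bit-parity-half x) (trans (cong (λ b → bit b + 2 * half x) even) (ℤ.+-identityˡ _))

  odd-view : ∀ x → parity x ≡ true → x ≡ 1 + 2 * half x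
  odd-view x odd = trans (bit-parity-half x) (cong (λ b → bit b + 2 * half x) odd)

  half-4* : ∀ {x} k → x ≡ 4 * k → half x ≡ 2 * k
  half-4* k eq = half-even (2 * k) (trans eq (regroup k))
    where
    regroup : ∀ k → 4 * k ≡ 2 * (2 * k)
    regroup = solve-∀

  half-2+4* : ∀ {x} k → x ≡ 2 + 4 * k → half x ≡ 1 + 2 * k
  half-2+4* k eq = half-even (1 + 2 * k) (trans eq (regroup k))
    where
    regroup : ∀ k → 2 + 4 * k ≡ 2 * (1 + 2 * k)
    regroup = solve-∀

  parity-half-4* : ∀ {x} k → x ≡ 4 * k → parity (half x) ≡ false
  parity-half-4* k eq = parity-even k (half-4* k eq)

  parity-half-2+4* : ∀ {x} k → x ≡ 2 + 4 * k → parity (half x) ≡ true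
  parity-half-2+4* k eq = parity-odd k (half-2+4* k eq)

open Parity

module QuaternaryForm where

  open import Data.Integer using (_+_; _-_; _*_)
  open import Data.Integer.Divisibility.Signed using (_∣_; _∣?_; divides)
  open import Data.Integer.Tactic.RingSolver using (solve-∀)
  open import Relation.Nullary.Decidable using (True; fromWitness)
  open import Data.Product.Properties using (≡-dec)
  import Data.Bool.Properties as Bool

  Q : ℤ × ℤ × ℤ × ℤ → ℤ
  Q (x , y , z , w) = x * x + 3 * (y * y) + 9 * (z * z) + 9 * (w * w)

  +-linear : ∀ a b c d p q r s →
    + (a ℕ.* p ℕ.+ b ℕ.* q ℕ.+ c ℕ.* r ℕ.+ d ℕ.* s) ≡ + a * + p + + b * + q + + c * + r + + d * + s
  +-linear a b c d p q r s =
    trans (ℤ.pos-+ (a ℕ.* p ℕ.+ b ℕ.* q ℕ.+ c ℕ.* r) (d ℕ.* s)) (cong₂ _+_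
      (trans (ℤ.pos-+ (a ℕ.* p ℕ.+ b ℕ.* q) (c ℕ.* r)) (cong₂ _+_
        (trans (ℤ.pos-+ (a ℕ.* p) (b ℕ.* q)) (cong₂ _+_ (ℤ.pos-* a p) (ℤ.pos-* b q)))
        (ℤ.pos-* c r)))
      (ℤ.pos-* d s))

  +sq≡square : ∀ x → + sq x ≡ x * x
  +sq≡square (+ n)    = ℤ.pos-* n n
  +sq≡square -[1+ n ] = refl

  +quadraticForm≡Q : ∀ v → + quadraticForm 1 3 9 9 v ≡ Q v
  +quadraticForm≡Q (x , y , z , w) = begin
    + quadraticForm 1 3 9 9 (x , y , z , w)
      ≡⟨ +-linear 1 3 9 9 (sq x) (sq y) (sq z) (sq w) ⟩
    1 * + sq x + 3 * + sq y + 9 * + sq z + 9 * + sq w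
      ≡⟨ cong₂ _+_ (cong₂ _+_ (cong₂ _+_ (trans (ℤ.*-identityˡ _) (+sq≡square x))
           (cong (3 *_) (+sq≡square y))) (cong (9 *_) (+sq≡square z))) (cong (9 *_) (+sq≡square w)) ⟩
    Q (x , y , z , w) ∎
    where open ≡-Reasoning

  Solution : ℤ → Pred (ℤ × ℤ × ℤ × ℤ) 0ℓ
  Solution k v = Q v ≡ 8 * k + 22

  parities : ℤ × ℤ × ℤ × ℤ → Bool × Bool × Bool × Bool
  parities (x , y , z , w) = parity x , parity y , parity z , parity w

  parities-≡ : ∀ {x y z w a b c d} → parities (x , y , z , w) ≡ (a , b , c , d) →
               parity x ≡ a × parity y ≡ b × parity z ≡ c × parity w ≡ d
  parities-≡ refl = refl , refl , refl , refl

  parities-≡⁺ : ∀ {x y z w a b c d} → parity x ≡ a → parity y ≡ b → parity z ≡ c → parity w ≡ d →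
                parities (x , y , z , w) ≡ (a , b , c , d)
  parities-≡⁺ refl refl refl refl = refl

  _≟₄_ : DecidableEquality (Bool × Bool × Bool × Bool)
  _≟₄_ = ≡-dec Bool._≟_ (≡-dec Bool._≟_ (≡-dec Bool._≟_ Bool._≟_))

  swap₃₄ : {A : Set} → A × A × A × A → A × A × A × A
  swap₃₄ (x , y , z , w) = x , y , w , z

  Q-swap₃₄ : ∀ v → Q (swap₃₄ v) ≡ Q v
  Q-swap₃₄ (x , y , z , w) = commute x y z w
    where
    commute : ∀ x y z w → x * x + 3 * (y * y) + 9 * (w * w) + 9 * (z * z) ≡ x * x + 3 * (y * y) + 9 * (z * z) + 9 * (w * w)
    commute = solve-∀

  bits : Bool × Bool × Bool × Bool → ℤ × ℤ × ℤ × ℤ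
  bits (a , b , c , d) = bit a , bit b , bit c , bit d

  Q-mod-4 : ∀ v → ∃ λ r → Q v ≡ Q (bits (parities v)) + 4 * r
  Q-mod-4 (x , y , z , w) = _ , (begin
    Q (x , y , z , w)
      ≡⟨ cong Q (cong₂ _,_ (bit-parity-half x) (cong₂ _,_ (bit-parity-half y)
           (cong₂ _,_ (bit-parity-half z) (bit-parity-half w)))) ⟩
    Q (bit (parity x) + 2 * half x , bit (parity y) + 2 * half y , bit (parity z) + 2 * half z , bit (parity w) + 2 * half w)
      ≡⟨ expand (bit (parity x)) (bit (parity y)) (bit (parity z)) (bit (parity w)) (half x) (half y) (half z) (half w) ⟩
    Q (bits (parities (x , y , z , w))) + 4 * _ ∎)
    where
    open ≡-Reasoning
    expand : ∀ a b c d p q r s →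
      (a + 2 * p) * (a + 2 * p) + 3 * ((b + 2 * q) * (b + 2 * q))
        + 9 * ((c + 2 * r) * (c + 2 * r)) + 9 * ((d + 2 * s) * (d + 2 * s)) ≡
      a * a + 3 * (b * b) + 9 * (c * c) + 9 * (d * d)
        + 4 * (a * p + p * p + 3 * (b * q + q * q) + 9 * (c * r + r * r) + 9 * (d * s + s * s))
    expand = solve-∀

  allOdd xyEven ywEven yzEven : Bool × Bool × Bool × Bool
  allOdd = true  , true  , true  , true
  xyEven = false , false , true  , true
  ywEven = true  , false , true  , false
  yzEven = true  , false , false , true

  admissible : List (Bool × Bool × Bool × Bool)
  admissible = allOdd ∷ xyEven ∷ ywEven ∷ yzEven ∷ []

  admissible-mod-4 : ∀ π → 4 ∣ Q (bits π) - 2 → π ∈ admissible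
  admissible-mod-4 π 4∣ = table π (fromWitness {a? = 4 ∣? (Q (bits π) - 2)} 4∣)
    where
    table : ∀ π → True (4 ∣? (Q (bits π) - 2)) → π ∈ admissible
    table (true  , true  , true  , true ) _ = here refl
    table (false , false , true  , true ) _ = there (here refl)
    table (true  , false , true  , false) _ = there (there (here refl))
    table (true  , false , false , true ) _ = there (there (there (here refl)))
    table (false , false , false , false) ()
    table (false , false , false , true ) ()
    table (false , false , true  , false) ()
    table (false , true  , false , false) ()
    table (false , true  , false , true ) ()
    table (false , true  , true  , false) ()
    table (false , true  , true  , true ) ()
    table (true  , false , false , false) ()
    table (true  , false , true  , true ) ()
    table (true  , true  , false , false) ()
    table (true  , true  , false , true ) ()
    table (true  , true  , true  , false) ()

  parities-admissible : ∀ k v → Solution k v → parities v ∈ admissible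
  parities-admissible k v Qv≡ = admissible-mod-4 (parities v) (divides (2 * k + 5 - r) (begin
      Qb - 2                    ≡⟨ shift Qb r ⟩
      Qb + 4 * r - 4 * r - 2    ≡⟨ cong (λ t → t - 4 * r - 2) (trans (sym Qv≡Qb+4r) Qv≡) ⟩
      8 * k + 22 - 4 * r - 2    ≡⟨ factor k r ⟩
      (2 * k + 5 - r) * 4       ∎))
    where
    open ≡-Reasoning
    Qb r : ℤ
    Qb = Q (bits (parities v))
    r = proj₁ (Q-mod-4 v)
    Qv≡Qb+4r : Q v ≡ Qb + 4 * r
    Qv≡Qb+4r = proj₂ (Q-mod-4 v)
    shift : ∀ q r → q - 2 ≡ q + 4 * r - 4 * r - 2
    shift = solve-∀
    factor : ∀ k r → 8 * k + 22 - 4 * r - 2 ≡ (2 * k + 5 - r) * 4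
    factor = solve-∀

open QuaternaryForm

module Rotation where

  open import Data.Integer using (_+_; _-_; _*_)
  open import Data.Integer.Tactic.RingSolver using (solve-∀)

  norm : ℤ × ℤ → ℤ
  norm (a , b) = a * a + 3 * (b * b)

  -- Multiplication of (a + b√−3)/2 by the units (1 + √−3)/2 and (1 − √−3)/2 of ℤ[(1 + √−3)/2].
  rot rot⁻¹ : ℤ × ℤ → ℤ × ℤ
  rot   (a , b) = half (a - 3 * b) , half (a + b)
  rot⁻¹ (a , b) = half (a + 3 * b) , half (b - a)

  halfSum : ℤ × ℤ → ℤ
  halfSum (a , b) = half (a + b)

  SameParity OddPair EvenPair : ℤ × ℤ → Set
  SameParity (a , b) = parity a ≡ parity b
  OddPair    (a , b) = parity a ≡ true  × parity b ≡ true
  EvenPair   (a , b) = parity a ≡ false × parity b ≡ false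

  oddPair⇒sameParity : ∀ {p} → OddPair p → SameParity p
  oddPair⇒sameParity (pa , pb) = trans pa (sym pb)

  evenPair⇒sameParity : ∀ {p} → EvenPair p → SameParity p
  evenPair⇒sameParity (pa , pb) = trans pa (sym pb)

  sameParity-elim : (P : ℤ × ℤ → Set) → (∀ c u v → P (c + 2 * u , c + 2 * v)) → ∀ {p} → SameParity p → P p
  sameParity-elim P shifted {a , b} same = subst P (sym view) (shifted (bit (parity a)) (half a) (half b))
    where
    view : (a , b) ≡ (bit (parity a) + 2 * half a , bit (parity a) + 2 * half b)
    view = cong₂ _,_ (bit-parity-half a) (trans (bit-parity-half b) (cong (λ c → bit c + 2 * half b) (sym same)))

  rot-shifted : ∀ c u v → rot (c + 2 * u , c + 2 * v) ≡ (u - 3 * v - c , u + v + c)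
  rot-shifted c u v = cong₂ _,_ (half-even _ (first c u v)) (half-even _ (second c u v))
    where
    first : ∀ c u v → c + 2 * u - 3 * (c + 2 * v) ≡ 2 * (u - 3 * v - c)
    first = solve-∀
    second : ∀ c u v → c + 2 * u + (c + 2 * v) ≡ 2 * (u + v + c)
    second = solve-∀

  rot⁻¹-shifted : ∀ c u v → rot⁻¹ (c + 2 * u , c + 2 * v) ≡ (u + 3 * v + 2 * c , v - u)
  rot⁻¹-shifted c u v = cong₂ _,_ (half-even _ (first c u v)) (half-even _ (second c u v))
    where
    first : ∀ c u v → c + 2 * u + 3 * (c + 2 * v) ≡ 2 * (u + 3 * v + 2 * c)
    first = solve-∀
    second : ∀ c u v → c + 2 * v - (c + 2 * u) ≡ 2 * (v - u)
    second = solve-∀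

  norm-rot : ∀ {p} → SameParity p → norm (rot p) ≡ norm p
  norm-rot {p} = sameParity-elim (λ p → norm (rot p) ≡ norm p)
    (λ c u v → trans (cong norm (rot-shifted c u v)) (same-norm c u v)) {p}
    where
    same-norm : ∀ c u v → (u - 3 * v - c) * (u - 3 * v - c) + 3 * ((u + v + c) * (u + v + c))
                        ≡ (c + 2 * u) * (c + 2 * u) + 3 * ((c + 2 * v) * (c + 2 * v))
    same-norm = solve-∀

  norm-rot⁻¹ : ∀ {p} → SameParity p → norm (rot⁻¹ p) ≡ norm p
  norm-rot⁻¹ {p} = sameParity-elim (λ p → norm (rot⁻¹ p) ≡ norm p)
    (λ c u v → trans (cong norm (rot⁻¹-shifted c u v)) (same-norm c u v)) {p}
    where
    same-norm : ∀ c u v → (u + 3 * v + 2 * c) * (u + 3 * v + 2 * c) + 3 * ((v - u) * (v - u))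
                        ≡ (c + 2 * u) * (c + 2 * u) + 3 * ((c + 2 * v) * (c + 2 * v))
    same-norm = solve-∀

  rot⁻¹-rot : ∀ {p} → SameParity p → rot⁻¹ (rot p) ≡ p
  rot⁻¹-rot {p} = sameParity-elim (λ p → rot⁻¹ (rot p) ≡ p) (λ c u v → trans (cong rot⁻¹ (rot-shifted c u v))
    (cong₂ _,_ (half-even _ (first c u v)) (half-even _ (second c u v)))) {p}
    where
    first : ∀ c u v → u - 3 * v - c + 3 * (u + v + c) ≡ 2 * (c + 2 * u)
    first = solve-∀
    second : ∀ c u v → u + v + c - (u - 3 * v - c) ≡ 2 * (c + 2 * v)
    second = solve-∀

  rot-rot⁻¹ : ∀ {p} → SameParity p → rot (rot⁻¹ p) ≡ p
  rot-rot⁻¹ {p} = sameParity-elim (λ p → rot (rot⁻¹ p) ≡ p) (λ c u v → trans (cong rot (rot⁻¹-shifted c u v))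
    (cong₂ _,_ (half-even _ (first c u v)) (half-even _ (second c u v)))) {p}
    where
    first : ∀ c u v → u + 3 * v + 2 * c - 3 * (v - u) ≡ 2 * (c + 2 * u)
    first = solve-∀
    second : ∀ c u v → u + 3 * v + 2 * c + (v - u) ≡ 2 * (c + 2 * v)
    second = solve-∀

  pair-view : ∀ {a b H B} → SameParity (a , b) → halfSum (a , b) ≡ H → b ≡ B → (a , b) ≡ (2 * H - B , B)
  pair-view {a} {b} {H} {B} same hs≡ b≡ = cong₂ _,_ (begin
    a                        ≡⟨ sameParity-elim (λ (a , b) → a ≡ 2 * halfSum (a , b) - b) shifted {a , b} same ⟩
    2 * halfSum (a , b) - b  ≡⟨ cong₂ (λ h b → 2 * h - b) hs≡ b≡ ⟩
    2 * H - B                ∎) b≡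
    where
    open ≡-Reasoning
    regroup : ∀ c u v → c + 2 * u ≡ 2 * (c + u + v) - (c + 2 * v)
    regroup = solve-∀
    sum : ∀ c u v → c + 2 * u + (c + 2 * v) ≡ 2 * (c + u + v)
    sum = solve-∀
    shifted : ∀ c u v → c + 2 * u ≡ 2 * halfSum (c + 2 * u , c + 2 * v) - (c + 2 * v)
    shifted c u v = trans (regroup c u v) (cong (λ h → 2 * h - (c + 2 * v)) (sym (half-even _ (sum c u v))))

  oddPair-oddHalfSum-elim : (P : ℤ × ℤ → Set) → (∀ m v → P (1 + 4 * m - 2 * v , 1 + 2 * v)) →
                            ∀ {p} → OddPair p → parity (halfSum p) ≡ true → P p
  oddPair-oddHalfSum-elim P form {a , b} (pa , pb) hs = subst P (sym view) (form m v)
    where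
    m v : ℤ
    m = half (halfSum (a , b))
    v = half b
    regroup : ∀ m v → 2 * (1 + 2 * m) - (1 + 2 * v) ≡ 1 + 4 * m - 2 * v
    regroup = solve-∀
    view : (a , b) ≡ (1 + 4 * m - 2 * v , 1 + 2 * v)
    view = trans (pair-view (trans pa (sym pb)) (odd-view (halfSum (a , b)) hs) (odd-view b pb)) (cong (_, _) (regroup m v))

  oddPair-evenHalfSum-elim : (P : ℤ × ℤ → Set) → (∀ m v → P (4 * m - 1 - 2 * v , 1 + 2 * v)) →
                             ∀ {p} → OddPair p → parity (halfSum p) ≡ false → P p
  oddPair-evenHalfSum-elim P form {a , b} (pa , pb) hs = subst P (sym view) (form m v)
    where
    m v : ℤ
    m = half (halfSum (a , b))
    v = half b
    regroup : ∀ m v → 2 * (2 * m) - (1 + 2 * v) ≡ 4 * m - 1 - 2 * v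
    regroup = solve-∀
    view : (a , b) ≡ (4 * m - 1 - 2 * v , 1 + 2 * v)
    view = trans (pair-view (trans pa (sym pb)) (even-view (halfSum (a , b)) hs) (odd-view b pb)) (cong (_, _) (regroup m v))

  evenPair-oddHalfSum-elim : (P : ℤ × ℤ → Set) → (∀ m v → P (2 + 4 * m - 2 * v , 2 * v)) →
                             ∀ {p} → EvenPair p → parity (halfSum p) ≡ true → P p
  evenPair-oddHalfSum-elim P form {a , b} (pa , pb) hs = subst P (sym view) (form m v)
    where
    m v : ℤ
    m = half (halfSum (a , b))
    v = half b
    regroup : ∀ m v → 2 * (1 + 2 * m) - 2 * v ≡ 2 + 4 * m - 2 * v
    regroup = solve-∀
    view : (a , b) ≡ (2 + 4 * m - 2 * v , 2 * v)
    view = trans (pair-view (trans pa (sym pb)) (odd-view (halfSum (a , b)) hs) (even-view b pb)) (cong (_, _) (regroup m v))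

  rot⁻¹-oddPair-oddHalfSum : ∀ {p} → OddPair p → parity (halfSum p) ≡ true → EvenPair (rot⁻¹ p)
  rot⁻¹-oddPair-oddHalfSum {p} = oddPair-oddHalfSum-elim (EvenPair ∘ rot⁻¹)
    (λ m v → parity-half-4* (1 + m + v) (first m v) , parity-half-4* (v - m) (second m v)) {p}
    where
    first : ∀ m v → 1 + 4 * m - 2 * v + 3 * (1 + 2 * v) ≡ 4 * (1 + m + v)
    first = solve-∀
    second : ∀ m v → 1 + 2 * v - (1 + 4 * m - 2 * v) ≡ 4 * (v - m)
    second = solve-∀

  rot-oddPair-evenHalfSum : ∀ {p} → OddPair p → parity (halfSum p) ≡ false → EvenPair (rot p)
  rot-oddPair-evenHalfSum {p} = oddPair-evenHalfSum-elim (EvenPair ∘ rot)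
    (λ m v → parity-half-4* (m - 1 - 2 * v) (first m v) , parity-half-4* m (second m v)) {p}
    where
    first : ∀ m v → 4 * m - 1 - 2 * v - 3 * (1 + 2 * v) ≡ 4 * (m - 1 - 2 * v)
    first = solve-∀
    second : ∀ m v → 4 * m - 1 - 2 * v + (1 + 2 * v) ≡ 4 * m
    second = solve-∀

  rot-evenPair-oddHalfSum : ∀ {p} → EvenPair p → parity (halfSum p) ≡ true →
                            OddPair (rot p) × parity (halfSum (rot p)) ≡ true
  rot-evenPair-oddHalfSum {p} = evenPair-oddHalfSum-elim (λ p → OddPair (rot p) × parity (halfSum (rot p)) ≡ true)
    (λ m v → (parity-half-2+4* (m - 2 * v) (first m v) , parity-half-2+4* m (second m v)) ,
             parity-half-2+4* (m - v)
               (trans (cong₂ _+_ (half-2+4* (m - 2 * v) (first m v)) (half-2+4* m (second m v))) (sum m v))) {p}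
    where
    first : ∀ m v → 2 + 4 * m - 2 * v - 3 * (2 * v) ≡ 2 + 4 * (m - 2 * v)
    first = solve-∀
    second : ∀ m v → 2 + 4 * m - 2 * v + 2 * v ≡ 2 + 4 * m
    second = solve-∀
    sum : ∀ m v → 1 + 2 * (m - 2 * v) + (1 + 2 * m) ≡ 2 + 4 * (m - v)
    sum = solve-∀

  rot⁻¹-evenPair-oddHalfSum : ∀ {p} → EvenPair p → parity (halfSum p) ≡ true →
                              OddPair (rot⁻¹ p) × parity (halfSum (rot⁻¹ p)) ≡ false
  rot⁻¹-evenPair-oddHalfSum {p} = evenPair-oddHalfSum-elim (λ p → OddPair (rot⁻¹ p) × parity (halfSum (rot⁻¹ p)) ≡ false)
    (λ m v → (parity-half-2+4* (m + v) (first m v) , parity-half-2+4* (v - m - 1) (second m v)) ,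
             parity-half-4* v
               (trans (cong₂ _+_ (half-2+4* (m + v) (first m v)) (half-2+4* (v - m - 1) (second m v))) (sum m v))) {p}
    where
    first : ∀ m v → 2 + 4 * m - 2 * v + 3 * (2 * v) ≡ 2 + 4 * (m + v)
    first = solve-∀
    second : ∀ m v → 2 * v - (2 + 4 * m - 2 * v) ≡ 2 + 4 * (v - m - 1)
    second = solve-∀
    sum : ∀ m v → 1 + 2 * (m + v) + (1 + 2 * (v - m - 1)) ≡ 4 * v
    sum = solve-∀

  even-sum⇒even-norm : ∀ a b → parity (a + b) ≡ false → parity (norm (a , b)) ≡ false
  even-sum⇒even-norm a b even = parity-even (2 * (s * s) + b * (b - a)) (begin
    a * a + 3 * (b * b)                      ≡⟨ complete-square a b ⟩
    (a + b) * (a + b) + 2 * (b * (b - a))    ≡⟨ cong (λ s → s * s + 2 * (b * (b - a))) (even-view (a + b) even) ⟩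
    2 * s * (2 * s) + 2 * (b * (b - a))      ≡⟨ factor s a b ⟩
    2 * (2 * (s * s) + b * (b - a))          ∎)
    where
    open ≡-Reasoning
    s : ℤ
    s = half (a + b)
    complete-square : ∀ a b → a * a + 3 * (b * b) ≡ (a + b) * (a + b) + 2 * (b * (b - a))
    complete-square = solve-∀
    factor : ∀ s a b → 2 * s * (2 * s) + 2 * (b * (b - a)) ≡ 2 * (2 * (s * s) + b * (b - a))
    factor = solve-∀

  odd-norm⇒odd-sum : ∀ a b → parity (norm (a , b)) ≡ true → parity (a + b) ≡ true
  odd-norm⇒odd-sum a b odd with parity (a + b) in sum-parity
  ... | true  = refl
  ... | false with () ← trans (sym odd) (even-sum⇒even-norm a b sum-parity)

  evenPair-halfSum : ∀ {p} → EvenPair p → parity (norm (half (proj₁ p) , half (proj₂ p))) ≡ true →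
                     parity (halfSum p) ≡ true
  evenPair-halfSum {a , b} (pa , pb) odd =
    subst (λ h → parity h ≡ true) (sym (half-even (half a + half b) sum≡)) (odd-norm⇒odd-sum (half a) (half b) odd)
    where
    sum≡ : a + b ≡ 2 * (half a + half b)
    sum≡ = trans (cong₂ _+_ (even-view a pa) (even-view b pb)) (sym (ℤ.*-distribˡ-+ 2 (half a) (half b)))

open Rotation

record PairLens (V : Set) : Set where
  field
    get     : V → ℤ × ℤ
    put     : ℤ × ℤ → V → V
    get-put : ∀ p v → get (put p v) ≡ p
    put-get : ∀ v → put (get v) v ≡ v
    put-put : ∀ p q v → put p (put q v) ≡ put p v

module PairRotation {V : Set} (lens : PairLens V) (S : Pred V 0ℓ)
  (S-norm : ∀ v p → norm p ≡ norm (PairLens.get lens v) → S v → S (PairLens.put lens p v))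
  (S-halfSum : ∀ v → S v → EvenPair (PairLens.get lens v) → parity (halfSum (PairLens.get lens v)) ≡ true)
  where

  open PairLens lens
  open import Data.Nat using (_+_; _*_)

  OddPairs EvenPairs : Pred V 0ℓ
  OddPairs  v = S v × OddPair (get v)
  EvenPairs v = S v × EvenPair (get v)

  along : (ℤ × ℤ → ℤ × ℤ) → V → V
  along f v = put (f (get v)) v

  along-inverse : ∀ f g v → g (f (get v)) ≡ get v → along g (along f v) ≡ v
  along-inverse f g v gf≡id = begin
    put (g (get (put (f (get v)) v))) (put (f (get v)) v)  ≡⟨ cong (λ p → put (g p) (put (f (get v)) v)) (get-put _ v) ⟩
    put (g (f (get v))) (put (f (get v)) v)                ≡⟨ put-put _ _ v ⟩
    put (g (f (get v))) v                                  ≡⟨ cong (λ p → put p v) gf≡id ⟩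
    put (get v) v                                          ≡⟨ put-get v ⟩
    v                                                      ∎
    where open ≡-Reasoning

  get-along : ∀ f {v} (Pair : Pred (ℤ × ℤ) 0ℓ) → Pair (f (get v)) → Pair (get (along f v))
  get-along f {v} Pair = subst Pair (sym (get-put (f (get v)) v))

  oddHalfSum≅evenPairs : Bijection (OddPairs ∩ λ v → parity (halfSum (get v)) ≡ true) EvenPairs
  oddHalfSum≅evenPairs = record
    { to      = along rot⁻¹
    ; from    = along rot
    ; to-∈    = λ {v} ((s , odd) , hs) →
        S-norm v _ (norm-rot⁻¹ (oddPair⇒sameParity odd)) s ,
        get-along rot⁻¹ EvenPair (rot⁻¹-oddPair-oddHalfSum odd hs)
    ; from-∈  = λ {v} (s , even) → let odd , hs = rot-evenPair-oddHalfSum even (S-halfSum v s even) in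
        (S-norm v _ (norm-rot (evenPair⇒sameParity even)) s , get-along rot OddPair odd) ,
        get-along rot (λ p → parity (halfSum p) ≡ true) hs
    ; from∘to = λ {v} ((_ , odd) , _) → along-inverse rot⁻¹ rot v (rot-rot⁻¹ (oddPair⇒sameParity odd))
    ; to∘from = λ {v} (_ , even) → along-inverse rot rot⁻¹ v (rot⁻¹-rot (evenPair⇒sameParity even))
    }

  evenHalfSum≅evenPairs : Bijection (OddPairs ∩ λ v → parity (halfSum (get v)) ≡ false) EvenPairs
  evenHalfSum≅evenPairs = record
    { to      = along rot
    ; from    = along rot⁻¹
    ; to-∈    = λ {v} ((s , odd) , hs) →
        S-norm v _ (norm-rot (oddPair⇒sameParity odd)) s ,
        get-along rot EvenPair (rot-oddPair-evenHalfSum odd hs)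
    ; from-∈  = λ {v} (s , even) → let odd , hs = rot⁻¹-evenPair-oddHalfSum even (S-halfSum v s even) in
        (S-norm v _ (norm-rot⁻¹ (evenPair⇒sameParity even)) s , get-along rot⁻¹ OddPair odd) ,
        get-along rot⁻¹ (λ p → parity (halfSum p) ≡ false) hs
    ; from∘to = λ {v} ((_ , odd) , _) → along-inverse rot rot⁻¹ v (rot⁻¹-rot (oddPair⇒sameParity odd))
    ; to∘from = λ {v} (_ , even) → along-inverse rot⁻¹ rot v (rot-rot⁻¹ (evenPair⇒sameParity even))
    }

  length-oddPairs : ∀ {xs ys} → Enumerates OddPairs xs → Enumerates EvenPairs ys → length xs ≡ 2 * length ys
  length-oddPairs {xs} {ys} odd even = begin
    length xs
      ≡⟨ length-fibres Bool._≟_ (parity ∘ halfSum ∘ get) (((λ ()) ∷ []) ∷ [] ∷ []) (λ _ → bools _) odd ⟩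
    length (with-halfSum true) + (length (with-halfSum false) + 0)
      ≡⟨ cong₂ (λ m n → m + (n + 0))
           (length-≡-bijection oddHalfSum≅evenPairs (enumerates-filter (halfSum≟ true) odd) even)
           (length-≡-bijection evenHalfSum≅evenPairs (enumerates-filter (halfSum≟ false) odd) even) ⟩
    length ys + (length ys + 0)
      ∎
    where
    open ≡-Reasoning
    halfSum≟ : ∀ b → Decidable λ v → parity (halfSum (get v)) ≡ b
    halfSum≟ b v = parity (halfSum (get v)) Bool.≟ b
    with-halfSum : Bool → List V
    with-halfSum b = filter (halfSum≟ b) xs
    bools : ∀ b → b ∈ true ∷ false ∷ []
    bools true  = here refl
    bools false = there (here refl)

module OddSquares where

  open import Data.Integer using (_+_; _-_; _*_; -_)
  open import Data.Integer.Tactic.RingSolver using (solve-∀)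
  open import Algebra.Properties.AbelianGroup ℤ.+-0-abelianGroup using () renaming (∙-cancelʳ to +-cancelʳ)

  signedIndex : ℤ → ℕ × Bool
  signedIndex (+ j)    = suc j , true
  signedIndex -[1+ j ] = suc j , false

  fromSignedIndex : ℕ × Bool → ℤ
  fromSignedIndex (a , true)  = + (a ∸ 1)
  fromSignedIndex (a , false) = -[1+ (a ∸ 1) ]

  fromSignedIndex-signedIndex : ∀ k → fromSignedIndex (signedIndex k) ≡ k
  fromSignedIndex-signedIndex (+ j)    = refl
  fromSignedIndex-signedIndex -[1+ j ] = refl

  signedIndex-fromSignedIndex : ∀ {a} s → 1 ≤ a → signedIndex (fromSignedIndex (a , s)) ≡ (a , s)
  signedIndex-fromSignedIndex {suc j} true  _ = refl
  signedIndex-fromSignedIndex {suc j} false _ = refl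

  1≤signedIndex : ∀ k → 1 ≤ proj₁ (signedIndex k)
  1≤signedIndex (+ j)    = s≤s z≤n
  1≤signedIndex -[1+ j ] = s≤s z≤n

  -- oddValue (a , true) = 2a − 1 and oddValue (a , false) = 1 − 2a for a ≥ 1 (a = 0 is junk);
  -- oddIndex inverts it on odd integers.
  oddValue : ℕ × Bool → ℤ
  oddValue i = 1 + 2 * fromSignedIndex i

  oddIndex : ℤ → ℕ × Bool
  oddIndex x = signedIndex (half x)

  oddIndex-oddValue : ∀ {a} s → 1 ≤ a → oddIndex (oddValue (a , s)) ≡ (a , s)
  oddIndex-oddValue {a} s 1≤a =
    trans (cong signedIndex (half-odd (fromSignedIndex (a , s)) refl)) (signedIndex-fromSignedIndex s 1≤a)

  oddValue-oddIndex : ∀ x → parity x ≡ true → oddValue (oddIndex x) ≡ x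
  oddValue-oddIndex x odd = trans (cong (λ k → 1 + 2 * k) (fromSignedIndex-signedIndex (half x))) (sym (odd-view x odd))

  parity-oddValue : ∀ i → parity (oddValue i) ≡ true
  parity-oddValue i = parity-odd (fromSignedIndex i) refl

  eight-tri' : ∀ j → 4 * ((1 + + j) * + j) ≡ 8 * + tri' (suc j)
  eight-tri' j = begin
    4 * ((1 + + j) * + j)         ≡⟨ cong (4 *_) (ℤ.pos-* (suc j) j) ⟨
    4 * + (suc j ℕ.* j)           ≡⟨ cong (λ t → 4 * + t) (double-tri' j) ⟨
    4 * + (2 ℕ.* tri' (suc j))    ≡⟨ cong (4 *_) (ℤ.pos-* 2 (tri' (suc j))) ⟩
    4 * (2 * + tri' (suc j))      ≡⟨ regroup (+ tri' (suc j)) ⟩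
    8 * + tri' (suc j)            ∎
    where
    open ≡-Reasoning
    regroup : ∀ t → 4 * (2 * t) ≡ 8 * t
    regroup = solve-∀

  square-oddValue : ∀ {a} s → 1 ≤ a → oddValue (a , s) * oddValue (a , s) ≡ 1 + 8 * + tri' a
  square-oddValue {suc j} true  _ = trans (expand (+ j)) (cong (λ t → 1 + t) (eight-tri' j))
    where
    expand : ∀ j → (1 + 2 * j) * (1 + 2 * j) ≡ 1 + 4 * ((1 + j) * j)
    expand = solve-∀
  square-oddValue {suc j} false _ = trans (expand (+ j)) (cong (λ t → 1 + t) (eight-tri' j))
    where
    expand : ∀ j → (1 + 2 * - (1 + j)) * (1 + 2 * - (1 + j)) ≡ 1 + 4 * ((1 + j) * j)
    expand = solve-∀

  odd-square : ∀ x → parity x ≡ true → x * x ≡ 1 + 8 * + tri' (proj₁ (oddIndex x))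
  odd-square x odd = begin
    x * x                                ≡⟨ cong (λ y → y * y) (oddValue-oddIndex x odd) ⟨
    oddValue (oddIndex x) * oddValue (oddIndex x)
                                         ≡⟨ square-oddValue (proj₂ (oddIndex x)) (1≤signedIndex (half x)) ⟩
    1 + 8 * + tri' (proj₁ (oddIndex x))  ∎
    where open ≡-Reasoning

  oddValues : (ℕ × ℕ × ℕ × ℕ) × (Bool × Bool × Bool × Bool) → ℤ × ℤ × ℤ × ℤ
  oddValues ((a , b , c , d) , (s , t , r , q)) = oddValue (a , s) , oddValue (b , t) , oddValue (c , r) , oddValue (d , q)

  oddIndices : ℤ × ℤ × ℤ × ℤ → (ℕ × ℕ × ℕ × ℕ) × (Bool × Bool × Bool × Bool)
  oddIndices (x , y , z , w) =
    (proj₁ (oddIndex x) , proj₁ (oddIndex y) , proj₁ (oddIndex z) , proj₁ (oddIndex w)) ,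
    (proj₂ (oddIndex x) , proj₂ (oddIndex y) , proj₂ (oddIndex z) , proj₂ (oddIndex w))

  Q-oddValues : ∀ u σ → AllPositive u → Q (oddValues (u , σ)) ≡ 8 * + triangularForm 1 3 9 9 u + 22
  Q-oddValues (a , b , c , d) (s , t , r , q) (1≤a , 1≤b , 1≤c , 1≤d) = begin
    Q (oddValues ((a , b , c , d) , (s , t , r , q)))
      ≡⟨ cong₂ _+_ (cong₂ _+_ (cong₂ _+_ (square-oddValue s 1≤a) (cong (3 *_) (square-oddValue t 1≤b)))
                              (cong (9 *_) (square-oddValue r 1≤c)))
                   (cong (9 *_) (square-oddValue q 1≤d)) ⟩
    1 + 8 * A + 3 * (1 + 8 * B) + 9 * (1 + 8 * C) + 9 * (1 + 8 * D)
      ≡⟨ regroup A B C D ⟩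
    8 * (1 * A + 3 * B + 9 * C + 9 * D) + 22
      ≡⟨ cong (λ t → 8 * t + 22) (+-linear 1 3 9 9 (tri' a) (tri' b) (tri' c) (tri' d)) ⟨
    8 * + triangularForm 1 3 9 9 (a , b , c , d) + 22
      ∎
    where
    open ≡-Reasoning
    A B C D : ℤ
    A = + tri' a
    B = + tri' b
    C = + tri' c
    D = + tri' d
    regroup : ∀ A B C D → 1 + 8 * A + 3 * (1 + 8 * B) + 9 * (1 + 8 * C) + 9 * (1 + 8 * D)
                        ≡ 8 * (1 * A + 3 * B + 9 * C + 9 * D) + 22
    regroup = solve-∀

  oddIndices-oddValues : ∀ u σ → AllPositive u → oddIndices (oddValues (u , σ)) ≡ (u , σ)
  oddIndices-oddValues (a , b , c , d) (s , t , r , q) (1≤a , 1≤b , 1≤c , 1≤d)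
    rewrite oddIndex-oddValue s 1≤a | oddIndex-oddValue t 1≤b | oddIndex-oddValue r 1≤c | oddIndex-oddValue q 1≤d
    = refl

  oddValues-oddIndices : ∀ {v} → parities v ≡ allOdd → oddValues (oddIndices v) ≡ v
  oddValues-oddIndices {x , y , z , w} allOdd≡ with ox , oy , oz , ow ← parities-≡ allOdd≡ =
    cong₂ _,_ (oddValue-oddIndex x ox) (cong₂ _,_ (oddValue-oddIndex y oy)
      (cong₂ _,_ (oddValue-oddIndex z oz) (oddValue-oddIndex w ow)))

  module _ (n : ℕ) where

    TriangularSolution : Pred (ℕ × ℕ × ℕ × ℕ) 0ℓ
    TriangularSolution u = AllPositive u × triangularForm 1 3 9 9 u ≡ n

    AllOddSolution : Pred (ℤ × ℤ × ℤ × ℤ) 0ℓ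
    AllOddSolution v = Solution (+ n) v × parities v ≡ allOdd

    triangular×signs≅allOdd : Bijection (TriangularSolution ⟨×⟩ λ _ → ⊤) AllOddSolution
    triangular×signs≅allOdd = record
      { to      = oddValues
      ; from    = oddIndices
      ; to-∈    = λ { {u , σ} ((positive , T≡n) , _) →
                      trans (Q-oddValues u σ positive) (cong (λ t → 8 * + t + 22) T≡n) , all-odd u σ }
      ; from-∈  = λ { {v} (Qv≡ , allOdd≡) → (positive v , triangular≡ v Qv≡ allOdd≡) , tt }
      ; from∘to = λ { {u , σ} ((positive , _) , _) → oddIndices-oddValues u σ positive }
      ; to∘from = λ (_ , allOdd≡) → oddValues-oddIndices allOdd≡
      }
      where
      all-odd : ∀ u σ → parities (oddValues (u , σ)) ≡ allOdd
      all-odd (a , b , c , d) (s , t , r , q) = cong₂ _,_ (parity-oddValue (a , s)) (cong₂ _,_ (parity-oddValue (b , t))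
                      (cong₂ _,_ (parity-oddValue (c , r)) (parity-oddValue (d , q))))
      positive : ∀ v → AllPositive (proj₁ (oddIndices v))
      positive (x , y , z , w) =
        1≤signedIndex (half x) , 1≤signedIndex (half y) , 1≤signedIndex (half z) , 1≤signedIndex (half w)
      triangular≡ : ∀ v → Solution (+ n) v → parities v ≡ allOdd → triangularForm 1 3 9 9 (proj₁ (oddIndices v)) ≡ n
      triangular≡ v Qv≡ allOdd≡ = ℤ.+-injective (ℤ.*-cancelˡ-≡ 8 _ _ (+-cancelʳ 22 _ _ (begin
        8 * + triangularForm 1 3 9 9 (proj₁ (oddIndices v)) + 22
          ≡⟨ Q-oddValues (proj₁ (oddIndices v)) (proj₂ (oddIndices v)) (positive v) ⟨
        Q (oddValues (oddIndices v))
          ≡⟨ cong Q (oddValues-oddIndices allOdd≡) ⟩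
        Q v
          ≡⟨ Qv≡ ⟩
        8 * + n + 22
          ∎)))
        where open ≡-Reasoning

open OddSquares

module CoordinatePairs where

  open import Data.Integer using (_+_; _-_; _*_)
  open import Data.Integer.Tactic.RingSolver using (solve-∀)

  xy yw : ℤ × ℤ × ℤ × ℤ → ℤ × ℤ
  xy (x , y , _ , _) = x , y
  yw (_ , y , _ , w) = y , w

  set-xy set-yw : ℤ × ℤ → ℤ × ℤ × ℤ × ℤ → ℤ × ℤ × ℤ × ℤ
  set-xy (a , b) (_ , _ , z , w) = a , b , z , w
  set-yw (a , b) (x , _ , z , _) = x , a , z , b

  xy-lens yw-lens : PairLens (ℤ × ℤ × ℤ × ℤ)
  xy-lens = record { get = xy ; put = set-xy ; get-put = λ _ _ → refl ; put-get = λ _ → refl ; put-put = λ _ _ _ → refl }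
  yw-lens = record { get = yw ; put = set-yw ; get-put = λ _ _ → refl ; put-get = λ _ → refl ; put-put = λ _ _ _ → refl }

  Q-yw : ∀ x y z w → Q (x , y , z , w) ≡ x * x + 9 * (z * z) + 3 * norm (y , w)
  Q-yw x y z w = regroup x y z w
    where
    regroup : ∀ x y z w →
      x * x + 3 * (y * y) + 9 * (z * z) + 9 * (w * w) ≡ x * x + 9 * (z * z) + 3 * (y * y + 3 * (w * w))
    regroup = solve-∀

  xyEven-quarterNorm : ∀ {k x y z w} → Solution k (x , y , z , w) →
    parity x ≡ false → parity y ≡ false → parity z ≡ true → parity w ≡ true → parity (norm (half x , half y)) ≡ true
  xyEven-quarterNorm {k} {x} {y} {z} {w} sol ex ey oz ow = parity-odd (k - 9 * tz - 9 * tw) (ℤ.*-cancelˡ-≡ 4 _ _ (begin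
    4 * norm (X , Y)                                  ≡⟨ quadruple X Y ⟩
    norm (2 * X , 2 * Y)                              ≡⟨ cong₂ (λ x y → norm (x , y)) (even-view x ex) (even-view y ey) ⟨
    norm (x , y)                                      ≡⟨ isolate x y z w ⟩
    Q (x , y , z , w) - 9 * (z * z) - 9 * (w * w)     ≡⟨ cong₂ (λ q s → q - 9 * s - 9 * (w * w)) sol (odd-square z oz) ⟩
    8 * k + 22 - 9 * (1 + 8 * tz) - 9 * (w * w)       ≡⟨ cong (λ s → 8 * k + 22 - 9 * (1 + 8 * tz) - 9 * s) (odd-square w ow) ⟩
    8 * k + 22 - 9 * (1 + 8 * tz) - 9 * (1 + 8 * tw)  ≡⟨ factor k tz tw ⟩
    4 * (1 + 2 * (k - 9 * tz - 9 * tw))               ∎))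
    where
    open ≡-Reasoning
    X Y tz tw : ℤ
    X = half x
    Y = half y
    tz = + tri' (proj₁ (oddIndex z))
    tw = + tri' (proj₁ (oddIndex w))
    quadruple : ∀ X Y → 4 * (X * X + 3 * (Y * Y)) ≡ 2 * X * (2 * X) + 3 * (2 * Y * (2 * Y))
    quadruple = solve-∀
    isolate : ∀ x y z w →
      x * x + 3 * (y * y) ≡ x * x + 3 * (y * y) + 9 * (z * z) + 9 * (w * w) - 9 * (z * z) - 9 * (w * w)
    isolate = solve-∀
    factor : ∀ k tz tw → 8 * k + 22 - 9 * (1 + 8 * tz) - 9 * (1 + 8 * tw) ≡ 4 * (1 + 2 * (k - 9 * tz - 9 * tw))
    factor = solve-∀

  ywEven-quarterNorm : ∀ {k x y z w} → Solution k (x , y , z , w) →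
    parity x ≡ true → parity y ≡ false → parity z ≡ true → parity w ≡ false → parity (norm (half y , half w)) ≡ true
  ywEven-quarterNorm {k} {x} {y} {z} {w} sol ox ey oz ew = parity-odd (K + 1 - q) (begin
    q                    ≡⟨ split q ⟩
    3 * q - 2 * q        ≡⟨ cong (λ t → t - 2 * q) three-q ⟩
    3 + 2 * K - 2 * q    ≡⟨ regroup K q ⟩
    1 + 2 * (K + 1 - q)  ∎)
    where
    open ≡-Reasoning
    Y W q tx tz K : ℤ
    Y = half y
    W = half w
    q = norm (Y , W)
    tx = + tri' (proj₁ (oddIndex x))
    tz = + tri' (proj₁ (oddIndex z))
    K = k - tx - 9 * tz
    split : ∀ q → q ≡ 3 * q - 2 * q
    split = solve-∀
    regroup : ∀ K q → 3 + 2 * K - 2 * q ≡ 1 + 2 * (K + 1 - q)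
    regroup = solve-∀
    three-q : 3 * q ≡ 3 + 2 * K
    three-q = ℤ.*-cancelˡ-≡ 4 _ _ (begin
      4 * (3 * q)                                   ≡⟨ quadruple Y W ⟩
      3 * norm (2 * Y , 2 * W)                      ≡⟨ cong₂ (λ y w → 3 * norm (y , w)) (even-view y ey) (even-view w ew) ⟨
      3 * norm (y , w)                              ≡⟨ isolate (x * x) (9 * (z * z)) (3 * norm (y , w)) ⟩
      x * x + 9 * (z * z) + 3 * norm (y , w) - x * x - 9 * (z * z)
                                                    ≡⟨ cong (λ t → t - x * x - 9 * (z * z)) (trans (sym (Q-yw x y z w)) sol) ⟩
      8 * k + 22 - x * x - 9 * (z * z)              ≡⟨ cong₂ (λ s t → 8 * k + 22 - s - 9 * t) (odd-square x ox) (odd-square z oz) ⟩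
      8 * k + 22 - (1 + 8 * tx) - 9 * (1 + 8 * tz)  ≡⟨ factor k tx tz ⟩
      4 * (3 + 2 * K)                               ∎)
      where
      quadruple : ∀ Y W → 4 * (3 * (Y * Y + 3 * (W * W))) ≡ 3 * (2 * Y * (2 * Y) + 3 * (2 * W * (2 * W)))
      quadruple = solve-∀
      isolate : ∀ s t b → b ≡ s + t + b - s - t
      isolate = solve-∀
      factor : ∀ k tx tz → 8 * k + 22 - (1 + 8 * tx) - 9 * (1 + 8 * tz) ≡ 4 * (3 + 2 * (k - tx - 9 * tz))
      factor = solve-∀

open CoordinatePairs

module Counting (n : ℕ) where

  open import Data.Integer using (_+_; _*_)

  +8*+22 : + (8 ℕ.* n ℕ.+ 22) ≡ 8 * + n + 22
  +8*+22 = trans (ℤ.pos-+ (8 ℕ.* n) 22) (cong (_+ 22) (ℤ.pos-* 8 n))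

  solutions : List (ℤ × ℤ × ℤ × ℤ)
  solutions = representations 1 3 9 9 (8 ℕ.* n ℕ.+ 22)

  enumerates-solutions : Enumerates (Solution (+ n)) solutions
  enumerates-solutions = enumerates-cong
    (λ {v} form≡ → trans (sym (+quadraticForm≡Q v)) (trans (cong +_ form≡) +8*+22))
    (λ {v} Q≡ → ℤ.+-injective (trans (+quadraticForm≡Q v) (trans Q≡ (sym +8*+22))))
    (enumerates-representations 1 3 9 9 (8 ℕ.* n ℕ.+ 22))

  withParities : Bool × Bool × Bool × Bool → List (ℤ × ℤ × ℤ × ℤ)
  withParities π = filter (λ v → parities v ≟₄ π) solutions

  enumerates-withParities : ∀ π → Enumerates (Solution (+ n) ∩ λ v → parities v ≡ π) (withParities π)
  enumerates-withParities π = enumerates-filter (λ v → parities v ≟₄ π) enumerates-solutions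

  length-solutions : length solutions ≡
    length (withParities allOdd) ℕ.+ (length (withParities xyEven) ℕ.+
      (length (withParities ywEven) ℕ.+ (length (withParities yzEven) ℕ.+ 0)))
  length-solutions =
    length-fibres _≟₄_ parities admissible-unique (λ {v} → parities-admissible (+ n) v) enumerates-solutions
    where
    admissible-unique : Unique admissible
    admissible-unique = ((λ ()) ∷ (λ ()) ∷ (λ ()) ∷ []) ∷ ((λ ()) ∷ (λ ()) ∷ []) ∷ ((λ ()) ∷ []) ∷ [] ∷ []

  t : ℕ
  t = t' 1 3 9 9 n

  length-allOdd : length (withParities allOdd) ≡ 16 ℕ.* t
  length-allOdd = begin
    length (withParities allOdd)
      ≡⟨ length-≡-bijection (Bijection-sym (triangular×signs≅allOdd n)) (enumerates-withParities allOdd)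
           (enumerates-cartesianProduct (enumerates-triangularRepresentations 1 3 9 9 n) enumerates-signs) ⟩
    length (cartesianProduct (triangularRepresentations 1 3 9 9 n) signs)
      ≡⟨ length-cartesianProduct (triangularRepresentations 1 3 9 9 n) signs ⟩
    length (triangularRepresentations 1 3 9 9 n) ℕ.* 16
      ≡⟨ cong (ℕ._* 16) (t'≡length-triangularRepresentations 1 3 9 9 n) ⟨
    t ℕ.* 16
      ≡⟨ ℕ.*-comm t 16 ⟩
    16 ℕ.* t
      ∎
    where open ≡-Reasoning

  half-of-allOdd : ∀ π → length (withParities allOdd) ≡ 2 ℕ.* length (withParities π) →
                   length (withParities π) ≡ 8 ℕ.* t
  half-of-allOdd π eq = ℕ.*-cancelˡ-≡ _ _ 2 (trans (sym eq) (trans length-allOdd (ℕ.*-assoc 2 8 t)))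

  SolutionWithOddZW SolutionWithOddXZ : Pred (ℤ × ℤ × ℤ × ℤ) 0ℓ
  SolutionWithOddZW v@(_ , _ , z , w) = Solution (+ n) v × parity z ≡ true × parity w ≡ true
  SolutionWithOddXZ v@(x , _ , z , _) = Solution (+ n) v × parity x ≡ true × parity z ≡ true

  xy-norm : ∀ v p → norm p ≡ norm (xy v) → SolutionWithOddZW v → SolutionWithOddZW (set-xy p v)
  xy-norm (_ , _ , z , w) _ norm≡ (sol , oz , ow) =
    trans (cong (λ t → t + 9 * (z * z) + 9 * (w * w)) norm≡) sol , oz , ow

  yw-norm : ∀ v p → norm p ≡ norm (yw v) → SolutionWithOddXZ v → SolutionWithOddXZ (set-yw p v)
  yw-norm (x , y , z , w) (a , b) norm≡ (sol , ox , oz) =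
    trans (Q-yw x a z b) (trans (cong (λ t → x * x + 9 * (z * z) + 3 * t) norm≡) (trans (sym (Q-yw x y z w)) sol)) ,
    ox , oz

  xy-halfSum : ∀ v → SolutionWithOddZW v → EvenPair (xy v) → parity (halfSum (xy v)) ≡ true
  xy-halfSum (x , y , _ , _) (sol , oz , ow) (ex , ey) =
    evenPair-halfSum {x , y} (ex , ey) (xyEven-quarterNorm {+ n} sol ex ey oz ow)

  yw-halfSum : ∀ v → SolutionWithOddXZ v → EvenPair (yw v) → parity (halfSum (yw v)) ≡ true
  yw-halfSum (_ , y , _ , w) (sol , ox , oz) (ey , ew) =
    evenPair-halfSum {y , w} (ey , ew) (ywEven-quarterNorm {+ n} sol ox ey oz ew)

  module XY = PairRotation xy-lens SolutionWithOddZW xy-norm xy-halfSum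
  module YW = PairRotation yw-lens SolutionWithOddXZ yw-norm yw-halfSum

  length-xyEven : length (withParities xyEven) ≡ 8 ℕ.* t
  length-xyEven = half-of-allOdd xyEven (XY.length-oddPairs
    (enumerates-cong
      (λ { {x , y , z , w} (sol , allOdd≡) → let ox , oy , oz , ow = parities-≡ allOdd≡ in (sol , oz , ow) , ox , oy })
      (λ { ((sol , oz , ow) , ox , oy) → sol , parities-≡⁺ ox oy oz ow })
      (enumerates-withParities allOdd))
    (enumerates-cong
      (λ { {x , y , z , w} (sol , xyEven≡) → let ex , ey , oz , ow = parities-≡ xyEven≡ in (sol , oz , ow) , ex , ey })
      (λ { ((sol , oz , ow) , ex , ey) → sol , parities-≡⁺ ex ey oz ow })
      (enumerates-withParities xyEven)))

  length-ywEven : length (withParities ywEven) ≡ 8 ℕ.* t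
  length-ywEven = half-of-allOdd ywEven (YW.length-oddPairs
    (enumerates-cong
      (λ { {x , y , z , w} (sol , allOdd≡) → let ox , oy , oz , ow = parities-≡ allOdd≡ in (sol , ox , oz) , oy , ow })
      (λ { ((sol , ox , oz) , oy , ow) → sol , parities-≡⁺ ox oy oz ow })
      (enumerates-withParities allOdd))
    (enumerates-cong
      (λ { {x , y , z , w} (sol , ywEven≡) → let ox , ey , oz , ew = parities-≡ ywEven≡ in (sol , ox , oz) , ey , ew })
      (λ { ((sol , ox , oz) , ey , ew) → sol , parities-≡⁺ ox ey oz ew })
      (enumerates-withParities ywEven)))

  length-yzEven : length (withParities yzEven) ≡ 8 ℕ.* t
  length-yzEven =
    trans (length-≡-bijection swap (enumerates-withParities yzEven) (enumerates-withParities ywEven)) length-ywEven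
    where
    swap : Bijection (Solution (+ n) ∩ λ v → parities v ≡ yzEven) (Solution (+ n) ∩ λ v → parities v ≡ ywEven)
    swap = record
      { to      = swap₃₄
      ; from    = swap₃₄
      ; to-∈    = λ {v} (sol , yzEven≡) → trans (Q-swap₃₄ v) sol , cong swap₃₄ yzEven≡
      ; from-∈  = λ {v} (sol , ywEven≡) → trans (Q-swap₃₄ v) sol , cong swap₃₄ ywEven≡
      ; from∘to = λ _ → refl
      ; to∘from = λ _ → refl
      }

open import Data.Nat using (_+_; _*_)
open import Data.Nat.Tactic.RingSolver using (solve-∀)

theorem2p1 : (n : ℕ) → 1 ≤ n → N 1 3 9 9 (8 * n + 22) ≡ 40 * t' 1 3 9 9 n
theorem2p1 n _ = begin
  N 1 3 9 9 (8 * n + 22)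
    ≡⟨ N≡length-representations 1 3 9 9 (8 * n + 22) ⟩
  length solutions
    ≡⟨ length-solutions ⟩
  length (withParities allOdd) + (length (withParities xyEven) +
    (length (withParities ywEven) + (length (withParities yzEven) + 0)))
    ≡⟨ cong₂ _+_ length-allOdd (cong₂ _+_ length-xyEven (cong₂ _+_ length-ywEven (cong (_+ 0) length-yzEven))) ⟩
  16 * t + (8 * t + (8 * t + (8 * t + 0)))
    ≡⟨ total t ⟩
  40 * t
    ∎
  where
  open ≡-Reasoning
  open Counting n
  total : ∀ t → 16 * t + (8 * t + (8 * t + (8 * t + 0))) ≡ 40 * t
  total = solve-∀
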